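{- Let $f\neq i$ be two classes with $s_f+P_f\ge s_i+P_i$, where $P_k=P(C_k)$. Let $T',T''>0$ satisfy $T'=2(s_f+P_f)/(\gamma_f(T')+2)$, $T''=2(s_i+P_i)/(\gamma_i(T'')+2)$, and $T''\le T'$. Then \[\frac{2(s_i+P_i)}{\gamma_i(T'')+3}\le\frac{2(s_f+P_f)}{\gamma_f(T')+3}.\]
   Context: In a scheduling instance each class $k$ has a setup time $s_k\in\mathbb{N}$ and jobs $C_k$ with processing times $t_j\in\mathbb{N}$; $P_k=P(C_k)=\sum_{j\in C_k}t_j$. For $T>0$ define $\beta_k(T)=\lceil 2P_k/T\rceil$, $\beta_k'(T)=\lfloor 2P_k/T\rfloor$, and $\gamma_k(T)=\max\{\beta_k'(T),1\}$ if $P_k-\beta_k'(T)\cdot\tfrac12T\le T-s_k$, and $\gamma_k(T)=\beta_k(T)$ otherwise. -}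

module Defs where

open import Data.Nat as ℕ using (ℕ; suc; _⊔_)
open import Data.Integer as ℤ using (ℤ; +_; ∣_∣)
open import Data.Rational using (ℚ; _≤?_; _÷_; _*_; _-_; floor; ceiling; Positive; ½; 1/_)
  renaming (_/_ to _÷ℕ_)
open import Data.Rational.Properties using (pos⇒nonZero)
open import Data.Fin using (Fin)
open import Data.List using (List)
open import Data.Nat.ListAction using (sum)
open import Relation.Nullary using (does)
open import Data.Bool using (if_then_else_)

-- A scheduling instance with m classes: class k has setup time s k
-- and a list of jobs (given by their processing times t_j ∈ ℕ).
record Instance (m : ℕ) : Set where
  field
    s    : Fin m → ℕ
    jobs : Fin m → List ℕ

  P : Fin m → ℕ
  P k = sum (jobs k)

ℕ→ℚ : ℕ → ℚ
ℕ→ℚ n = (+ n) ÷ℕ 1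

module _ {m : ℕ} (I : Instance m) where
  open Instance I

  twoP/T : Fin m → (T : ℚ) → .{{Positive T}} → ℚ
  twoP/T k T = _÷_ (ℕ→ℚ (2 ℕ.* P k)) T {{pos⇒nonZero T}}

  -- β_k(T) = ⌈2P_k/T⌉  (a nonnegative integer since T > 0)
  β : Fin m → (T : ℚ) → .{{Positive T}} → ℕ
  β k T = ∣ ceiling (twoP/T k T) ∣

  -- β'_k(T) = ⌊2P_k/T⌋  (a nonnegative integer since T > 0)
  β' : Fin m → (T : ℚ) → .{{Positive T}} → ℕ
  β' k T = ∣ floor (twoP/T k T) ∣

  γ : Fin m → (T : ℚ) → .{{Positive T}} → ℕ
  γ k T = if does ((ℕ→ℚ (P k) - ℕ→ℚ (β' k T) * (½ * T)) ≤? (T - ℕ→ℚ (s k)))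
             then β' k T ⊔ 1
             else β k T

-- Write A = 2(s_f + P_f), a = γ_f(T′) and B = 2(s_i + P_i), b = γ_i(T″).
module Submission where

open import Defs
open import Data.Nat using (ℕ; _+_; _*_; _≥_; suc; NonZero)
open import Data.Nat.Properties using (*-monoʳ-≤)
open import Data.Integer as ℤ using (+_; +≤+)
open import Data.Integer.Properties using (*-suc; +-mono-≤)
open import Data.Rational using (ℚ; Positive; _≤_) renaming (_/_ to _÷ℕ_)
open import Data.Rational.Properties using (toℚᵘ-mono-≤; toℚᵘ-cancel-≤; toℚᵘ-fromℚᵘ)
open import Data.Rational.Unnormalised using (mkℚᵘ; *≤*)
open import Data.Rational.Unnormalised.Properties using (≤-respˡ-≃; ≤-respʳ-≃; ≃-sym)
open import Data.Fin using (Fin)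
open import Function.Bundles using (_⇔_; mk⇔; Equivalence)
open import Relation.Binary.PropositionalEquality using (_≡_; _≢_; subst₂; sym)

/-≤⇔*-≤ : ∀ p q x y .{{_ : NonZero x}} .{{_ : NonZero y}} →
          (p ÷ℕ x ≤ q ÷ℕ y) ⇔ (p ℤ.* + y ℤ.≤ q ℤ.* + x)
/-≤⇔*-≤ p q (suc x) (suc y) = mk⇔ to from
  where
  to : p ÷ℕ suc x ≤ q ÷ℕ suc y → p ℤ.* + suc y ℤ.≤ q ℤ.* + suc x
  to le with ≤-respʳ-≃ (toℚᵘ-fromℚᵘ (mkℚᵘ q y))
               (≤-respˡ-≃ (toℚᵘ-fromℚᵘ (mkℚᵘ p x)) (toℚᵘ-mono-≤ le))
  ... | *≤* cross = cross

  from : p ℤ.* + suc y ℤ.≤ q ℤ.* + suc x → p ÷ℕ suc x ≤ q ÷ℕ suc y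
  from cross = toℚᵘ-cancel-≤
    (≤-respʳ-≃ (≃-sym (toℚᵘ-fromℚᵘ (mkℚᵘ q y)))
      (≤-respˡ-≃ (≃-sym (toℚᵘ-fromℚᵘ (mkℚᵘ p x))) (*≤* cross)))

/-suc-mono-≤ : ∀ {p q} x y .{{_ : NonZero x}} .{{_ : NonZero y}} → p ℤ.≤ q →
               p ÷ℕ x ≤ q ÷ℕ y → p ÷ℕ suc x ≤ q ÷ℕ suc y
/-suc-mono-≤ {p} {q} x y p≤q le =
  Equivalence.from (/-≤⇔*-≤ p q (suc x) (suc y))
    (subst₂ ℤ._≤_ (sym (*-suc p (+ y))) (sym (*-suc q (+ x)))
      (+-mono-≤ p≤q (Equivalence.to (/-≤⇔*-≤ p q x y) le)))

lemma4p7 : {m : ℕ} (I : Instance m) (f i : Fin m) → f ≢ i →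
    Instance.s I f + Instance.P I f ≥ Instance.s I i + Instance.P I i →
    (T′ T″ : ℚ) .{{_ : Positive T′}} .{{_ : Positive T″}} →
    T′ ≡ (+ (2 * (Instance.s I f + Instance.P I f))) ÷ℕ (2 + γ I f T′) →
    T″ ≡ (+ (2 * (Instance.s I i + Instance.P I i))) ÷ℕ (2 + γ I i T″) →
    T″ ≤ T′ →
    (+ (2 * (Instance.s I i + Instance.P I i))) ÷ℕ (3 + γ I i T″)
      ≤ (+ (2 * (Instance.s I f + Instance.P I f))) ÷ℕ (3 + γ I f T′)
lemma4p7 I f i _ load-i≤load-f T′ T″ T′-eq T″-eq T″≤T′ =
  /-suc-mono-≤ (2 + γ I i T″) (2 + γ I f T′)
    (+≤+ (*-monoʳ-≤ 2 load-i≤load-f))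
    (subst₂ _≤_ T″-eq T′-eq T″≤T′)
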